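{- Let $q$ be a prime with $q\equiv 3\pmod{20}$ or $q\equiv 7\pmod{20}$. Then the set $\{r\in\mathbb{N}\colon q^r(q-1)+1\text{ is composite}\}$ contains an infinite arithmetic progression. -}

{-# OPTIONS --safe #-}
-- If q ≡ 3 (mod 20) then q ≡ 3 (mod 5), and if q ≡ 7 (mod 20) then q ≡ 2 (mod 5); in both
-- cases q⁴ ≡ 1 (mod 5), so q^(a+4k) ≡ q^a.  With a = 3, resp. a = 2, this gives
-- q^(a+4k)(q − 1) + 1 ≡ 27·2 + 1, resp. 4·1 + 1, ≡ 0 (mod 5), and these numbers exceed 5.
module Submission where

open import Data.Nat using (ℕ; _+_; _*_; _∸_; _^_; _%_; _<_; _≤_; zero; suc; pred; NonZero; z≤n; s≤s; z<s)
open import Data.Nat.Primality using (Prime; Composite; composite)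
open import Data.Nat.Divisibility using (divides; m%n≡0⇒n∣m)
open import Data.Nat.DivMod using (%-distribˡ-+; %-distribˡ-*; [m+n]%n≡m%n; m∣n⇒o%n%m≡o%m; m%n≤m)
open import Data.Nat.Properties
  using (+-suc; +-assoc; +-identityʳ; +-comm; *-identityʳ; ^-distribˡ-+-*; suc-pred; ≤-refl; ≤-reflexive; ≤-trans; m≤m+n; ≤-pred; *-mono-≤; m≤m*n; m^n≢0; module ≤-Reasoning)
open import Data.Product using (∃-syntax; _×_; _,_)
open import Data.Sum using (_⊎_; inj₁; inj₂)
open import Relation.Binary.PropositionalEquality using (_≡_; refl; sym; trans; cong; cong₂; module ≡-Reasoning)

module Congruence (n : ℕ) .{{_ : NonZero n}} where

  infix 4 _≋_

  -- A record rather than an abbreviation, so that x and y can be inferred from x ≋ y.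
  record _≋_ (x y : ℕ) : Set where
    constructor mod-≡
    field %≡% : x % n ≡ y % n

  open _≋_ public

  ≋-trans : ∀ {a b c} → a ≋ b → b ≋ c → a ≋ c
  ≋-trans (mod-≡ a≡b) (mod-≡ b≡c) = mod-≡ (trans a≡b b≡c)

  ≡⇒≋ : ∀ {a b} → a ≡ b → a ≋ b
  ≡⇒≋ refl = mod-≡ refl

  +-≋ : ∀ {a b c d} → a ≋ b → c ≋ d → a + c ≋ b + d
  +-≋ {a} {b} {c} {d} (mod-≡ a≡b) (mod-≡ c≡d) = mod-≡ (begin
    (a + c) % n           ≡⟨ %-distribˡ-+ a c n ⟩
    (a % n + c % n) % n   ≡⟨ cong₂ (λ x y → (x + y) % n) a≡b c≡d ⟩
    (b % n + d % n) % n   ≡⟨ %-distribˡ-+ b d n ⟨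
    (b + d) % n           ∎)
    where open ≡-Reasoning

  *-≋ : ∀ {a b c d} → a ≋ b → c ≋ d → a * c ≋ b * d
  *-≋ {a} {b} {c} {d} (mod-≡ a≡b) (mod-≡ c≡d) = mod-≡ (begin
    (a * c) % n           ≡⟨ %-distribˡ-* a c n ⟩
    (a % n * (c % n)) % n ≡⟨ cong₂ (λ x y → (x * y) % n) a≡b c≡d ⟩
    (b % n * (d % n)) % n ≡⟨ %-distribˡ-* b d n ⟨
    (b * d) % n           ∎)
    where open ≡-Reasoning

  ^-≋ : ∀ {a b} → a ≋ b → ∀ k → a ^ k ≋ b ^ k
  ^-≋ a≋b zero    = mod-≡ refl
  ^-≋ a≋b (suc k) = *-≋ a≋b (^-≋ a≋b k)

  -- Adding n − 1 to both sides turns suc x into x + n.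
  suc-injective-≋ : ∀ {x y} → suc x ≋ suc y → x ≋ y
  suc-injective-≋ {x} {y} sx≋sy = mod-≡ (begin
    x % n                ≡⟨ %≡% (shift x) ⟨
    (suc x + pred n) % n ≡⟨ %≡% (+-≋ sx≋sy (mod-≡ {pred n} refl)) ⟩
    (suc y + pred n) % n ≡⟨ %≡% (shift y) ⟩
    y % n                ∎)
    where
    open ≡-Reasoning
    shift : ∀ z → suc z + pred n ≋ z
    shift z = ≋-trans (≡⇒≋ (trans (sym (+-suc z (pred n))) (cong (z +_) (suc-pred n))))
                      (mod-≡ ([m+n]%n≡m%n z n))

  ^-periodic-≋ : ∀ {q p} → q ^ p ≋ 1 → ∀ a k → q ^ (a + k * p) ≋ q ^ a
  ^-periodic-≋ {q}     qᵖ≋1 a zero    = ≡⇒≋ (cong (q ^_) (+-identityʳ a))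
  ^-periodic-≋ {q} {p} qᵖ≋1 a (suc k) =
    ≋-trans (≡⇒≋ split)
      (≋-trans (*-≋ (^-periodic-≋ qᵖ≋1 a k) qᵖ≋1) (≡⇒≋ (*-identityʳ (q ^ a))))
    where
    split : q ^ (a + (p + k * p)) ≡ q ^ (a + k * p) * q ^ p
    split = trans (cong (q ^_) (trans (cong (a +_) (+-comm p (k * p))) (sym (+-assoc a (k * p) p))))
                  (^-distribˡ-+-* q (a + k * p) p)

  ^-progression-≋ : ∀ {q b p} → q ≋ b → b ^ p ≋ 1 → ∀ a k → q ^ (a + k * p) ≋ b ^ a
  ^-progression-≋ {p = p} q≋b bᵖ≋1 a k =
    ≋-trans (^-periodic-≋ (≋-trans (^-≋ q≋b p) bᵖ≋1) a k) (^-≋ q≋b a)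

open Congruence 5

5<[1+q]^[1+r]*q+1 : ∀ {q} r → 2 ≤ q → 5 < suc q ^ suc r * q + 1
5<[1+q]^[1+r]*q+1 {q} r 2≤q = begin
  6                     ≤⟨ *-mono-≤ (s≤s 2≤q) 2≤q ⟩
  suc q * q             ≤⟨ *-mono-≤ (m≤m*n (suc q) (suc q ^ r)) ≤-refl ⟩
  suc q ^ suc r * q     ≤⟨ m≤m+n _ 1 ⟩
  suc q ^ suc r * q + 1 ∎
  where
  open ≤-Reasoning
  instance _ = m^n≢0 (suc q) r

composite-along-progression : ∀ {q b} a → 2 ≤ q → suc q ≋ suc b → suc b ^ 4 ≋ 1 →
  suc b ^ suc a * b + 1 ≋ 0 → ∀ k → Composite (suc q ^ (suc a + k * 4) * q + 1)
composite-along-progression {q} {b} a 2≤q q≋b b⁴≋1 residue≋0 k =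
  composite {5} (5<[1+q]^[1+r]*q+1 (a + k * 4) 2≤q) (m%n≡0⇒n∣m _ 5 (%≡% N≋0))
  where
  N≋residue : suc q ^ (suc a + k * 4) * q + 1 ≋ suc b ^ suc a * b + 1
  N≋residue = +-≋ (*-≋ (^-progression-≋ q≋b b⁴≋1 (suc a) k) (suc-injective-≋ q≋b)) (mod-≡ refl)
  N≋0 : suc q ^ (suc a + k * 4) * q + 1 ≋ 0
  N≋0 = ≋-trans N≋residue residue≋0

≡[mod20]⇒≋ : ∀ {q r} → q % 20 ≡ r → q ≋ r
≡[mod20]⇒≋ {q} q≡r = mod-≡ (trans (sym (m∣n⇒o%n%m≡o%m 5 20 q (divides 4 refl))) (cong (_% 5) q≡r))

remainder≤ : ∀ {q r} → q % 20 ≡ r → r ≤ q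
remainder≤ {q} q≡r = ≤-trans (≤-reflexive (sym q≡r)) (m%n≤m q 20)

lemma3p20 : (q : ℕ) → Prime q → (q % 20 ≡ 3 ⊎ q % 20 ≡ 7) →
    ∃[ a ] ∃[ d ] (0 < d × (∀ (k : ℕ) → Composite (q ^ (a + k * d) * (q ∸ 1) + 1)))
lemma3p20 zero    _ (inj₁ ())
lemma3p20 zero    _ (inj₂ ())
lemma3p20 (suc q) _ (inj₁ q≡3) =
  3 , 4 , z<s , composite-along-progression 2 (≤-pred (remainder≤ q≡3)) (≡[mod20]⇒≋ q≡3)
                                             (mod-≡ refl) (mod-≡ refl)
lemma3p20 (suc q) _ (inj₂ q≡7) =
  2 , 4 , z<s , composite-along-progression 1 (≤-pred (≤-trans 3≤7 (remainder≤ q≡7))) (≡[mod20]⇒≋ q≡7)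
                                             (mod-≡ refl) (mod-≡ refl)
  where
  3≤7 : 3 ≤ 7
  3≤7 = s≤s (s≤s (s≤s z≤n))
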